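{- For every integer $n\ge 3$ there exists a strong in-domatic critical digraph $D$ of order $2n$ with $\mathsf{d}_s^-(D)=n$.
   Context: Digraphs are finite, loopless, without parallel arcs. A digraph is strong if for every ordered pair $u,v$ there is a directed $uv$-walk. $S\subseteq V(D)$ is in-dominating if every vertex not in $S$ has an out-neighbor in $S$; strong in-dominating if moreover $D\langle S\rangle$ is strong. $\mathsf{d}_s^-(D)$ is the maximum number of classes of a partition of $V(D)$ into strong in-dominating sets. $D$ is a strong in-domatic critical digraph if for every arc $a$ of $D$, $D-a$ is strong and $\mathsf{d}_s^-(D-a)=\mathsf{d}_s^-(D)-1$. -}

module Defs where

open import Data.Nat using (ℕ; _≤_; pred)
open import Data.Fin using (Fin; _≟_)
open import Data.Bool using (Bool; true; false; _∧_; not)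
open import Data.Product using (Σ; ∃; ∃-syntax; _×_; _,_)
open import Relation.Nullary using (¬_)
open import Relation.Nullary.Decidable using (⌊_⌋)
open import Relation.Binary.PropositionalEquality using (_≡_; _≢_; refl)
open import Relation.Unary using (Pred; _∈_; _∉_; Universal; U)
open import Level using (0ℓ)

-- A finite digraph of order m on vertex set Fin m: the arc relation is a
-- Boolean matrix (so no parallel arcs), with no loops.
record Digraph (m : ℕ) : Set where
  field
    arc      : Fin m → Fin m → Bool
    loopless : ∀ x → arc x x ≡ false
open Digraph public

deleteArc : ∀ {m} → Digraph m → Fin m → Fin m → Digraph m
deleteArc D u v = record
  { arc      = λ x y → arc D x y ∧ not (⌊ x ≟ u ⌋ ∧ ⌊ y ≟ v ⌋)
  ; loopless = λ x → lem x }
  where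
  lem : ∀ x → (arc D x x ∧ not (⌊ x ≟ u ⌋ ∧ ⌊ x ≟ v ⌋)) ≡ false
  lem x rewrite loopless D x = refl

-- directed walks from x to y using only vertices of S (i.e. walks in D⟨S⟩)
data WalkIn {m} (D : Digraph m) (S : Pred (Fin m) 0ℓ) : Fin m → Fin m → Set where
  [_]  : ∀ {x} → x ∈ S → WalkIn D S x x
  _∷⟨_⟩_ : ∀ {x w y} → x ∈ S → arc D x w ≡ true → WalkIn D S w y → WalkIn D S x y

InducedStrong : ∀ {m} → Digraph m → Pred (Fin m) 0ℓ → Set
InducedStrong D S = ∀ x y → x ∈ S → y ∈ S → WalkIn D S x y

Strong : ∀ {m} → Digraph m → Set
Strong D = InducedStrong D U

InDominating : ∀ {m} → Digraph m → Pred (Fin m) 0ℓ → Set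
InDominating D S = ∀ x → x ∉ S → ∃[ y ] (y ∈ S × arc D x y ≡ true)

StrongInDominating : ∀ {m} → Digraph m → Pred (Fin m) 0ℓ → Set
StrongInDominating D S = InDominating D S × InducedStrong D S

Class : ∀ {m k} → (Fin m → Fin k) → Fin k → Pred (Fin m) 0ℓ
Class c j x = c x ≡ j

-- a partition of V(D) into k (nonempty) strong in-dominating sets,
-- given as a surjective class assignment c : V → Fin k
StrongInDomaticPartition : ∀ {m} → Digraph m → (k : ℕ) → Set
StrongInDomaticPartition {m} D k =
  Σ (Fin m → Fin k) λ c →
    (∀ j → ∃[ x ] c x ≡ j) × (∀ j → StrongInDominating D (Class c j))

StrongInDomaticNumber : ∀ {m} → Digraph m → ℕ → Set
StrongInDomaticNumber D d =
  StrongInDomaticPartition D d × (∀ k → StrongInDomaticPartition D k → k ≤ d)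

StrongInDomaticCritical : ∀ {m} → Digraph m → ℕ → Set
StrongInDomaticCritical D d =
  StrongInDomaticNumber D d ×
  (∀ u v → arc D u v ≡ true →
     Strong (deleteArc D u v) × StrongInDomaticNumber (deleteArc D u v) (pred d))

-- D is the symmetric digraph of the rook's graph K₂ □ Kₙ. Every vertex has a vertex
-- outside its closed in-neighbourhood, so every in-dominating set has at least two
-- vertices and at most n classes fit into 2n vertices; the n columns attain this.
-- Deleting an arc uv keeps every union of columns strong unless u's column is alone
-- in it, since a path of three arcs replaces uv; merging u's column with v's (or with
-- any other one when they coincide) thus leaves n − 1 classes in D − uv. A partition of
-- D − uv into n classes would consist of 2-cycles. The 2-cycle through v is not inside
-- a row, for a cell of the other row in a third column would be undominated, so it is
-- a column. Then u neither lies in it nor has an arc into it: its arc to v is gone,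
-- and no vertex has arcs to both cells of a column.

module Submission where

open import Defs
open import Data.Nat using (ℕ; suc; _+_; _≤_; _*_; pred; s≤s)
import Data.Nat.Properties as ℕ
open import Data.Fin using (Fin; zero; suc; _≟_; remQuot; combine; punchIn; punchOut)
open import Data.Fin.Properties
  using ( remQuot-combine; combine-remQuot; combine-injective; injective⇒≤
        ; punchInᵢ≢i; punchIn-injective; punchIn-punchOut; punchOut-cong; punchOut-punchIn)
open import Data.Bool using (Bool; true; false; _xor_)
open import Data.Bool.Properties using (∧-zeroʳ)
open import Data.Product using (Σ; ∃-syntax; _×_; _,_; proj₁; proj₂; uncurry)
open import Data.Sum using (_⊎_; inj₁; inj₂; [_,_]′)
import Data.Sum as Sum
open import Data.Empty using (⊥; ⊥-elim)
open import Data.Unit using (⊤; tt)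
open import Function using (_∘_)
open import Relation.Nullary using (¬_; yes; no)
open import Relation.Nullary.Decidable using (⌊_⌋; _×-dec_)
open import Relation.Binary.PropositionalEquality
  using (_≡_; _≢_; refl; sym; trans; cong; subst; module ≡-Reasoning)
open import Relation.Unary using (Pred; _∈_; _∉_; Decidable)
open import Level using (0ℓ)

private
  variable
    m d : ℕ

false≢true : false ≢ true
false≢true ()

another : Fin (suc (suc m)) → Fin (suc (suc m))
another i = punchIn i zero

another-≢ : (i : Fin (suc (suc m))) → another i ≢ i
another-≢ i = punchInᵢ≢i i zero

avoiding₂ : (i j : Fin (3 + m)) → ∃[ t ] t ≢ i × t ≢ j
avoiding₂ i j with i ≟ j
... | yes refl = another i , another-≢ i , another-≢ i
... | no i≢j   = punchIn i t , punchInᵢ≢i i t , punchIn-t≢j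
  where
  t = another (punchOut i≢j)
  punchIn-t≢j : punchIn i t ≢ j
  punchIn-t≢j e = another-≢ (punchOut i≢j)
    (punchIn-injective i _ _ (trans e (sym (punchIn-punchOut i≢j))))

Fin2-≢⇒≡ : ∀ {r s t : Fin 2} → s ≢ r → t ≢ r → s ≡ t
Fin2-≢⇒≡ {zero}     {zero}     s≢r _   = ⊥-elim (s≢r refl)
Fin2-≢⇒≡ {zero}     {suc zero} {zero}     _ t≢r = ⊥-elim (t≢r refl)
Fin2-≢⇒≡ {zero}     {suc zero} {suc zero} _ _   = refl
Fin2-≢⇒≡ {suc zero} {suc zero} s≢r _   = ⊥-elim (s≢r refl)
Fin2-≢⇒≡ {suc zero} {zero}     {zero}     _ _   = refl
Fin2-≢⇒≡ {suc zero} {zero}     {suc zero} _ t≢r = ⊥-elim (t≢r refl)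

merge : {a b : Fin (suc m)} → b ≢ a → Fin (suc m) → Fin m
merge {b = b} b≢a x with b ≟ x
... | yes _   = punchOut b≢a
... | no b≢x  = punchOut b≢x

module _ {a b : Fin (suc m)} (b≢a : b ≢ a) where

  merge-punchIn : ∀ x → merge b≢a (punchIn b x) ≡ x
  merge-punchIn x with b ≟ punchIn b x
  ... | yes b≡ = ⊥-elim (punchInᵢ≢i b x (sym b≡))
  ... | no _   = trans (punchOut-cong b refl) (punchOut-punchIn b)

  merge-identifies : merge b≢a b ≡ merge b≢a a
  merge-identifies with b ≟ b | b ≟ a
  ... | yes _  | yes b≡a = ⊥-elim (b≢a b≡a)
  ... | yes _  | no _    = punchOut-cong b refl
  ... | no b≢b | _       = ⊥-elim (b≢b refl)

_⊆ᴬ_ : Digraph m → Digraph m → Set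
G ⊆ᴬ D = ∀ x y → arc G x y ≡ true → arc D x y ≡ true

module _ {D : Digraph m} {u v : Fin m} where

  deleteArc-⊆ᴬ : deleteArc D u v ⊆ᴬ D
  deleteArc-⊆ᴬ x y a with arc D x y
  ... | true  = refl
  ... | false = a

  deleteArc-keeps : ∀ {x y} → arc D x y ≡ true → ¬ (x ≡ u × y ≡ v) →
                    arc (deleteArc D u v) x y ≡ true
  deleteArc-keeps {x} {y} a ¬uv rewrite a with x ≟ u | y ≟ v
  ... | yes x≡u | yes y≡v = ⊥-elim (¬uv (x≡u , y≡v))
  ... | yes _   | no _    = refl
  ... | no _    | _       = refl

  deleteArc-removes : arc (deleteArc D u v) u v ≡ false
  deleteArc-removes with u ≟ u | v ≟ v
  ... | yes _ | yes _  = ∧-zeroʳ (arc D u v)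
  ... | no u≢u | _     = ⊥-elim (u≢u refl)
  ... | yes _ | no v≢v = ⊥-elim (v≢v refl)

module _ {D : Digraph m} {S : Pred (Fin m) 0ℓ} where

  walk-head : ∀ {x y} → WalkIn D S x y → x ∈ S
  walk-head [ xS ]        = xS
  walk-head (xS ∷⟨ _ ⟩ _) = xS

  _++ʷ_ : ∀ {x y z} → WalkIn D S x y → WalkIn D S y z → WalkIn D S x z
  [ _ ]            ++ʷ q = q
  (xS ∷⟨ a ⟩ p) ++ʷ q = xS ∷⟨ a ⟩ (p ++ʷ q)

  stay-or-step : ∀ {x w y} → x ∈ S → x ≡ w ⊎ arc D x w ≡ true →
                 WalkIn D S w y → WalkIn D S x y
  stay-or-step _  (inj₁ refl) p = p
  stay-or-step xS (inj₂ a)    p = xS ∷⟨ a ⟩ p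

  walk⇒arc : ∀ {a b} → (∀ z → z ∈ S → z ≡ a ⊎ z ≡ b) → a ≢ b →
             WalkIn D S a b → arc D a b ≡ true
  walk⇒arc only a≢b [ _ ] = ⊥-elim (a≢b refl)
  walk⇒arc {a} only a≢b (_∷⟨_⟩_ {w = w} _ a→w p) with only w (walk-head p)
  ... | inj₁ refl = ⊥-elim (false≢true (trans (sym (loopless D a)) a→w))
  ... | inj₂ refl = a→w

module _ {D : Digraph m} {S : Pred (Fin m) 0ℓ} {u v : Fin m} where

  reroute : (u ∈ S → v ∈ S → WalkIn (deleteArc D u v) S u v) →
            ∀ {x y} → WalkIn D S x y → WalkIn (deleteArc D u v) S x y
  reroute detour [ xS ] = [ xS ]
  reroute detour (_∷⟨_⟩_ {x} {w} xS a p) with (x ≟ u) ×-dec (w ≟ v)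
  ... | yes (refl , refl) = detour xS (walk-head p) ++ʷ reroute detour p
  ... | no ¬uv            = xS ∷⟨ deleteArc-keeps {D = D} a ¬uv ⟩ reroute detour p

  deleteArc-inducedStrong : InducedStrong D S →
                            (u ∈ S → v ∈ S → WalkIn (deleteArc D u v) S u v) →
                            InducedStrong (deleteArc D u v) S
  deleteArc-inducedStrong strong detour x y xS yS = reroute detour (strong x y xS yS)

  detour₃ : ∀ {a b} → u ∈ S → a ∈ S → b ∈ S → v ∈ S →
            arc D u a ≡ true → arc D a b ≡ true → arc D b v ≡ true →
            a ≢ v → a ≢ u → b ≢ u → WalkIn (deleteArc D u v) S u v
  detour₃ uS aS bS vS u→a a→b b→v a≢v a≢u b≢u =
    uS ∷⟨ deleteArc-keeps {D = D} u→a (λ (_ , a≡v) → a≢v a≡v) ⟩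
    (aS ∷⟨ deleteArc-keeps {D = D} a→b (λ (a≡u , _) → a≢u a≡u) ⟩
    (bS ∷⟨ deleteArc-keeps {D = D} b→v (λ (b≡u , _) → b≢u b≡u) ⟩ [ vS ]))

HasNonInNeighbours : Digraph m → Set
HasNonInNeighbours D = ∀ x → ∃[ y ] y ≢ x × arc D y x ≡ false

HasNonInNeighbours-⊆ᴬ : {G D : Digraph m} → G ⊆ᴬ D → HasNonInNeighbours D → HasNonInNeighbours G
HasNonInNeighbours-⊆ᴬ {G = G} G⊆D noArcs x with noArcs x
... | y , y≢x , ¬y→x = y , y≢x , lemma
  where
  lemma : arc G y x ≡ false
  lemma with arc G y x in y→x
  ... | false = refl
  ... | true  = ⊥-elim (false≢true (trans (sym ¬y→x) (G⊆D y x y→x)))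

record TwoMembers (S : Pred (Fin m) 0ℓ) : Set where
  field
    fst snd  : Fin m
    fst∈     : fst ∈ S
    snd∈     : snd ∈ S
    fst≢snd  : fst ≢ snd

open TwoMembers

-- The non-in-neighbour y of x is either in S or dominated by a vertex of S other than x.
inDominating-twoMembers : {D : Digraph m} {S : Pred (Fin m) 0ℓ} → HasNonInNeighbours D →
                          Decidable S → InDominating D S → ∀ {x} → x ∈ S → TwoMembers S
inDominating-twoMembers noArcs S? dom {x} xS with noArcs x
... | y , y≢x , ¬y→x with S? y
...   | yes yS = record { fst = x ; snd = y ; fst∈ = xS ; snd∈ = yS ; fst≢snd = y≢x ∘ sym }
...   | no y∉S with dom y y∉S
...     | z , zS , y→z = record { fst = x ; snd = z ; fst∈ = xS ; snd∈ = zS ; fst≢snd = x≢z }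
  where
  x≢z : x ≢ z
  x≢z refl = false≢true (trans (sym ¬y→x) y→z)

module ClassPairs {c : Fin m → Fin d} (pair : ∀ j → TwoMembers (Class c j)) where

  member : Fin 2 × Fin d → Fin m
  member (zero     , j) = fst (pair j)
  member (suc zero , j) = snd (pair j)

  member-class : ∀ t j → c (member (t , j)) ≡ j
  member-class zero       j = fst∈ (pair j)
  member-class (suc zero) j = snd∈ (pair j)

  member-pair : ∀ {z j} p → c z ≡ j → z ≡ member p → z ≡ fst (pair j) ⊎ z ≡ snd (pair j)
  member-pair (t , j′) cz≡j z≡m with trans (sym (member-class t j′)) (trans (cong c (sym z≡m)) cz≡j)
  member-pair (zero     , j) _ z≡m | refl = inj₁ z≡m
  member-pair (suc zero , j) _ z≡m | refl = inj₂ z≡m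

  member-injectiveˡ : ∀ {j} t t′ → member (t , j) ≡ member (t′ , j) → t ≡ t′
  member-injectiveˡ zero       zero       _ = refl
  member-injectiveˡ zero       (suc zero) e = ⊥-elim (fst≢snd (pair _) e)
  member-injectiveˡ (suc zero) zero       e = ⊥-elim (fst≢snd (pair _) (sym e))
  member-injectiveˡ (suc zero) (suc zero) _ = refl

  member-injective : ∀ {p q} → member p ≡ member q → p ≡ q
  member-injective {t , j} {t′ , j′} e
    with trans (sym (member-class t j)) (trans (cong c e) (member-class t′ j′))
  ... | refl = cong (_, j) (member-injectiveˡ t t′ e)

  members : Fin (2 * d) → Fin m
  members = member ∘ remQuot d

  members-injective : ∀ {i i′} → members i ≡ members i′ → i ≡ i′
  members-injective {i} {i′} e = begin
    i                                   ≡⟨ combine-remQuot {2} d i ⟨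
    uncurry combine (remQuot {2} d i)   ≡⟨ cong (uncurry combine) remQuot≡ ⟩
    uncurry combine (remQuot {2} d i′)  ≡⟨ combine-remQuot {2} d i′ ⟩
    i′                                  ∎
    where
    open ≡-Reasoning
    remQuot≡ = member-injective {remQuot d i} {remQuot d i′} e

  2*d≤m : 2 * d ≤ m
  2*d≤m = injective⇒≤ members-injective

  -- A third member of a class would extend members to an injection Fin (1 + 2d) → Fin m.
  class≡pair : m ≤ 2 * d → ∀ {j z} → c z ≡ j → z ≡ fst (pair j) ⊎ z ≡ snd (pair j)
  class≡pair m≤2d {j} {z} cz≡j with z ≟ fst (pair j) | z ≟ snd (pair j)
  ... | yes z≡fst | _         = inj₁ z≡fst
  ... | no _      | yes z≡snd = inj₂ z≡snd
  ... | no z≢fst  | no z≢snd  = ⊥-elim (ℕ.<⇒≱ (injective⇒≤ extended-injective) m≤2d)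
    where
    outside : ∀ p → z ≢ member p
    outside p z≡m = [ z≢fst , z≢snd ]′ (member-pair p cz≡j z≡m)

    extended : Fin (suc (2 * d)) → Fin m
    extended zero    = z
    extended (suc i) = members i

    extended-injective : ∀ {i i′} → extended i ≡ extended i′ → i ≡ i′
    extended-injective {zero}  {zero}   _ = refl
    extended-injective {zero}  {suc i′} e = ⊥-elim (outside (remQuot d i′) e)
    extended-injective {suc i} {zero}   e = ⊥-elim (outside (remQuot d i) (sym e))
    extended-injective {suc i} {suc i′} e = cong suc (members-injective e)

  classmate : m ≤ 2 * d → ∀ x →
              ∃[ w ] c w ≡ c x × x ≢ w × (∀ z → c z ≡ c x → z ≡ x ⊎ z ≡ w)
  classmate m≤2d x with class≡pair m≤2d {c x} {x} refl
  ... | inj₁ x≡fst = snd (pair (c x)) , snd∈ (pair (c x)) ,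
                     (λ x≡snd → fst≢snd (pair (c x)) (trans (sym x≡fst) x≡snd)) ,
                     λ z cz → Sum.map₁ (λ z≡fst → trans z≡fst (sym x≡fst)) (class≡pair m≤2d cz)
  ... | inj₂ x≡snd = fst (pair (c x)) , fst∈ (pair (c x)) ,
                     (λ x≡fst → fst≢snd (pair (c x)) (trans (sym x≡fst) x≡snd)) ,
                     λ z cz → Sum.swap (Sum.map₂ (λ z≡snd → trans z≡snd (sym x≡snd))
                                                 (class≡pair m≤2d cz))

classes-twoMembers : {D : Digraph m} {c : Fin m → Fin d} → HasNonInNeighbours D →
                     (∀ j → ∃[ x ] c x ≡ j) → (∀ j → InDominating D (Class c j)) →
                     ∀ j → TwoMembers (Class c j)
classes-twoMembers {D = D} {c = c} noArcs onto dom j =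
  inDominating-twoMembers {D = D} noArcs (λ x → c x ≟ j) (dom j) (proj₂ (onto j))

strongInDomaticPartition-bound : {D : Digraph m} → HasNonInNeighbours D →
                                 StrongInDomaticPartition D d → 2 * d ≤ m
strongInDomaticPartition-bound {D = D} noArcs (_ , onto , sid) =
  ClassPairs.2*d≤m (classes-twoMembers {D = D} noArcs onto (proj₁ ∘ sid))

-- The symmetric digraph of the rook's graph K₂ □ Kₙ: cell r i of the 2 × n grid is
-- joined to every other cell of row r and of column i.
module Rook (k : ℕ) where

  n : ℕ
  n = 3 + k

  V : Set
  V = Fin (2 * n)

  cell : Fin 2 → Fin n → V
  cell = combine

  row : V → Fin 2
  row x = proj₁ (remQuot {2} n x)

  col : V → Fin n
  col x = proj₂ (remQuot {2} n x)

  row-cell : ∀ r i → row (cell r i) ≡ r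
  row-cell r i = cong proj₁ (remQuot-combine r i)

  col-cell : ∀ r i → col (cell r i) ≡ i
  col-cell r i = cong proj₂ (remQuot-combine r i)

  data CellView : V → Set where
    cellAt : ∀ r i → CellView (cell r i)

  cellView : ∀ x → CellView x
  cellView x = subst CellView (combine-remQuot {2} n x) (cellAt (row x) (col x))

  cell-≢ʳ : ∀ {r s i j} → r ≢ s → cell r i ≢ cell s j
  cell-≢ʳ {r} {s} {i} {j} r≢s e = r≢s (proj₁ (combine-injective r i s j e))

  cell-≢ᶜ : ∀ {r s i j} → i ≢ j → cell r i ≢ cell s j
  cell-≢ᶜ {r} {s} {i} {j} i≢j e = i≢j (proj₂ (combine-injective r i s j e))

  rookArc : V → V → Bool
  rookArc x y = ⌊ row x ≟ row y ⌋ xor ⌊ col x ≟ col y ⌋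

  rookArc-loopless : ∀ x → rookArc x x ≡ false
  rookArc-loopless x with row x ≟ row x | col x ≟ col x
  ... | yes _    | yes _    = refl
  ... | no  r≢r  | _        = ⊥-elim (r≢r refl)
  ... | yes _    | no  i≢i  = ⊥-elim (i≢i refl)

  rook : Digraph (2 * n)
  rook = record { arc = rookArc ; loopless = rookArc-loopless }

  rookArc-cell : ∀ r i s j → rookArc (cell r i) (cell s j) ≡ (⌊ r ≟ s ⌋ xor ⌊ i ≟ j ⌋)
  rookArc-cell r i s j rewrite row-cell r i | row-cell s j | col-cell r i | col-cell s j = refl

  arc-inRow : ∀ r {i j} → i ≢ j → rookArc (cell r i) (cell r j) ≡ true
  arc-inRow r {i} {j} i≢j rewrite rookArc-cell r i r j with r ≟ r | i ≟ j
  ... | yes _  | no _    = refl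
  ... | no r≢r | _       = ⊥-elim (r≢r refl)
  ... | yes _  | yes i≡j = ⊥-elim (i≢j i≡j)

  arc-inCol : ∀ {r s} i → r ≢ s → rookArc (cell r i) (cell s i) ≡ true
  arc-inCol {r} {s} i r≢s rewrite rookArc-cell r i s i with r ≟ s | i ≟ i
  ... | no _    | yes _  = refl
  ... | yes r≡s | _      = ⊥-elim (r≢s r≡s)
  ... | no _    | no i≢i = ⊥-elim (i≢i refl)

  no-arc : ∀ {r s i j} → r ≢ s → i ≢ j → rookArc (cell r i) (cell s j) ≡ false
  no-arc {r} {s} {i} {j} r≢s i≢j rewrite rookArc-cell r i s j with r ≟ s | i ≟ j
  ... | no _    | no _    = refl
  ... | yes r≡s | _       = ⊥-elim (r≢s r≡s)
  ... | no _    | yes i≡j = ⊥-elim (i≢j i≡j)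

  arc-cases : ∀ r i s j → rookArc (cell r i) (cell s j) ≡ true →
              (r ≡ s × i ≢ j) ⊎ (r ≢ s × i ≡ j)
  arc-cases r i s j a rewrite rookArc-cell r i s j with r ≟ s | i ≟ j
  ... | yes r≡s | no i≢j  = inj₁ (r≡s , i≢j)
  ... | no r≢s  | yes i≡j = inj₂ (r≢s , i≡j)
  ... | yes _   | yes _   = ⊥-elim (false≢true a)
  ... | no _    | no _    = ⊥-elim (false≢true a)

  ≡⊎arc-inRow : ∀ r i j → cell r i ≡ cell r j ⊎ rookArc (cell r i) (cell r j) ≡ true
  ≡⊎arc-inRow r i j with i ≟ j
  ... | yes refl = inj₁ refl
  ... | no i≢j   = inj₂ (arc-inRow r i≢j)

  ≡⊎arc-inCol : ∀ r s j → cell r j ≡ cell s j ⊎ rookArc (cell r j) (cell s j) ≡ true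
  ≡⊎arc-inCol r s j with r ≟ s
  ... | yes refl = inj₁ refl
  ... | no r≢s   = inj₂ (arc-inCol j r≢s)

  rook-nonInNeighbours : HasNonInNeighbours rook
  rook-nonInNeighbours x with cellView x
  ... | cellAt r i = cell (another r) (another i) , cell-≢ʳ (another-≢ r) ,
                     no-arc (another-≢ r) (another-≢ i)

  colSet : (Fin n → Set) → Pred V 0ℓ
  colSet P x = P (col x)

  module _ (P : Fin n → Set) {r : Fin 2} {i : Fin n} where

    cell∈colSet : P i → cell r i ∈ colSet P
    cell∈colSet = subst P (sym (col-cell r i))

    cell∈colSet⁻ : cell r i ∈ colSet P → P i
    cell∈colSet⁻ = subst P (col-cell r i)

  cell∈colSet-moveRow : ∀ P {r s i} → cell r i ∈ colSet P → cell s i ∈ colSet P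
  cell∈colSet-moveRow P {r} {s} {i} = cell∈colSet P {s} {i} ∘ cell∈colSet⁻ P {r} {i}

  colSet-inducedStrong : ∀ P → InducedStrong rook (colSet P)
  colSet-inducedStrong P x y xS yS with cellView x | cellView y
  ... | cellAt r i | cellAt s j =
    stay-or-step {D = rook} xS (≡⊎arc-inRow r i j)
      (stay-or-step {D = rook} (cell∈colSet-moveRow P {s} {r} yS) (≡⊎arc-inCol r s j) [ yS ])

  colPartition : StrongInDomaticPartition rook n
  colPartition = col , onto , λ j → dominating j , colSet-inducedStrong (_≡ j)
    where
    onto : ∀ j → ∃[ x ] col x ≡ j
    onto j = cell zero j , col-cell zero j

    dominating : ∀ j → InDominating rook (Class col j)
    dominating j x x∉ with cellView x
    ... | cellAt r i = cell r j , col-cell r j ,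
                       arc-inRow r (λ i≡j → x∉ (trans (col-cell r i) i≡j))

  subdigraph-bound : ∀ {G d} → G ⊆ᴬ rook → StrongInDomaticPartition G d → d ≤ n
  subdigraph-bound {G} G⊆rook p = ℕ.*-cancelˡ-≤ 2
    (strongInDomaticPartition-bound {D = G}
      (HasNonInNeighbours-⊆ᴬ {G = G} {D = rook} G⊆rook rook-nonInNeighbours) p)

  rook-number : StrongInDomaticNumber rook n
  rook-number = colPartition , λ _ → subdigraph-bound {rook} (λ _ _ a → a)

  -- The opposite cell of a third column has no arc into a row pair.
  rowPair-notInDominating : ∀ {G S s j j′} → G ⊆ᴬ rook → InDominating G S →
                            (∀ z → z ∈ S → z ≡ cell s j ⊎ z ≡ cell s j′) → ⊥
  rowPair-notInDominating {G} {S} {s} {j} {j′} G⊆rook dom only with avoiding₂ j j′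
  ... | t , t≢j , t≢j′ = undominated (dom (cell (another s) t) t∉S)
    where
    t∉S : cell (another s) t ∉ S
    t∉S tS = [ cell-≢ʳ (another-≢ s) , cell-≢ʳ (another-≢ s) ]′ (only _ tS)

    undominated : ¬ (∃[ z ] z ∈ S × arc G (cell (another s) t) z ≡ true)
    undominated (z , zS , t→z) with only z zS
    ... | inj₁ refl = false≢true (trans (sym (no-arc (another-≢ s) t≢j)) (G⊆rook _ _ t→z))
    ... | inj₂ refl = false≢true (trans (sym (no-arc (another-≢ s) t≢j′)) (G⊆rook _ _ t→z))

  column-noCommonInNeighbour : ∀ {x s s′ j} → s ≢ s′ →
    rookArc x (cell s j) ≡ true → rookArc x (cell s′ j) ≡ true → ⊥
  column-noCommonInNeighbour {x} {s} {s′} {j} s≢s′ x→sj x→s′j with cellView x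
  ... | cellAt r i with arc-cases r i s j x→sj | arc-cases r i s′ j x→s′j
  ... | inj₁ (r≡s , _)   | inj₁ (r≡s′ , _)  = s≢s′ (trans (sym r≡s) r≡s′)
  ... | inj₁ (_ , i≢j)   | inj₂ (_ , i≡j)   = i≢j i≡j
  ... | inj₂ (_ , i≡j)   | inj₁ (_ , i≢j)   = i≢j i≡j
  ... | inj₂ (r≢s , _)   | inj₂ (r≢s′ , _)  = s≢s′ (Fin2-≢⇒≡ (r≢s ∘ sym) (r≢s′ ∘ sym))

  module Deleted {r s : Fin 2} {i j : Fin n} (u→v : rookArc (cell r i) (cell s j) ≡ true) where

    u v : V
    u = cell r i
    v = cell s j

    G : Digraph (2 * n)
    G = deleteArc rook u v

    G⊆rook : G ⊆ᴬ rook
    G⊆rook = deleteArc-⊆ᴬ {D = rook} {u} {v}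

    G-nonInNeighbours : HasNonInNeighbours G
    G-nonInNeighbours = HasNonInNeighbours-⊆ᴬ {G = G} {D = rook} G⊆rook rook-nonInNeighbours

    ¬G-uv : arc G u v ≢ true
    ¬G-uv = false≢true ∘ trans (sym (deleteArc-removes {D = rook} {u} {v}))

    u≢v : u ≢ v
    u≢v u≡v = false≢true
      (trans (sym (rookArc-loopless u)) (subst (λ y → rookArc u y ≡ true) (sym u≡v) u→v))

    -- Both detours avoid the arc uv by leaving u through a cell other than v.
    detour : ∀ P → (P i → ∃[ i′ ] P i′ × i′ ≢ i) →
             u ∈ colSet P → v ∈ colSet P → WalkIn G (colSet P) u v
    detour P spare uS vS with arc-cases r i s j u→v
    ... | inj₁ (refl , i≢j) =
      detour₃ {D = rook} {a = cell r′ i} {b = cell r′ j}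
        uS (cell∈colSet-moveRow P {r} {r′} uS) (cell∈colSet-moveRow P {r} {r′} vS) vS
        (arc-inCol i (another-≢ r ∘ sym)) (arc-inRow r′ i≢j) (arc-inCol j (another-≢ r))
        (cell-≢ʳ {i = i} {j} (another-≢ r)) (cell-≢ʳ {i = i} {i} (another-≢ r))
        (cell-≢ʳ {i = j} {i} (another-≢ r))
      where r′ = another r
    ... | inj₂ (r≢s , refl) with spare (cell∈colSet⁻ P {r} uS)
    ...   | i′ , Pi′ , i′≢i =
      detour₃ {D = rook} {a = cell r i′} {b = cell s i′}
        uS (cell∈colSet P {r} Pi′) (cell∈colSet P {s} Pi′) vS
        (arc-inRow r (i′≢i ∘ sym)) (arc-inCol i′ r≢s) (arc-inRow s i′≢i)
        (cell-≢ᶜ {r} {s} i′≢i) (cell-≢ᶜ {r} {r} i′≢i) (cell-≢ᶜ {s} {r} i′≢i)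

    G-colSet-inducedStrong : ∀ P → (P i → ∃[ i′ ] P i′ × i′ ≢ i) → InducedStrong G (colSet P)
    G-colSet-inducedStrong P spare =
      deleteArc-inducedStrong {D = rook} (colSet-inducedStrong P) (detour P spare)

    G-strong : Strong G
    G-strong = G-colSet-inducedStrong (λ _ → ⊤) (λ _ → another i , tt , another-≢ i)

    -- u's column i is merged with v's column j, which loses its only arc from u; when
    -- i ≡ j, column i alone would no longer be strong and is merged with any other column.
    partnerColumn : ∃[ b ] b ≢ i × (j ≡ i ⊎ j ≡ b)
    partnerColumn with j ≟ i
    ... | yes j≡i = another i , another-≢ i , inj₁ j≡i
    ... | no j≢i  = j , j≢i , inj₂ refl

    b : Fin n
    b = proj₁ partnerColumn

    b≢i : b ≢ i
    b≢i = proj₁ (proj₂ partnerColumn)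

    mergedCol : Fin n → Fin (pred n)
    mergedCol = merge b≢i

    mergedCol-j≡i : mergedCol j ≡ mergedCol i
    mergedCol-j≡i with proj₂ (proj₂ partnerColumn)
    ... | inj₁ j≡i = cong mergedCol j≡i
    ... | inj₂ j≡b = trans (cong mergedCol j≡b) (merge-identifies b≢i)

    mergedPartition : StrongInDomaticPartition G (pred n)
    mergedPartition = mergedCol ∘ col , onto , λ c → dominating c ,
                      G-colSet-inducedStrong (λ i′ → mergedCol i′ ≡ c) (spare c)
      where
      onto : ∀ c → ∃[ x ] mergedCol (col x) ≡ c
      onto c = cell zero (punchIn b c) ,
               trans (cong mergedCol (col-cell zero (punchIn b c))) (merge-punchIn b≢i c)

      spare : ∀ c → mergedCol i ≡ c → ∃[ i′ ] mergedCol i′ ≡ c × i′ ≢ i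
      spare c i∈c = b , trans (merge-identifies b≢i) i∈c , b≢i

      dominating : ∀ c → InDominating G (Class (mergedCol ∘ col) c)
      dominating c x x∉ with cellView x
      ... | cellAt r′ i′ = cell r′ (punchIn b c) ,
                          trans (cong mergedCol (col-cell r′ (punchIn b c))) (merge-punchIn b≢i c) ,
                          deleteArc-keeps {D = rook} (arc-inRow r′ i′≢) not-uv
        where
        i′∉ : mergedCol i′ ≢ c
        i′∉ = x∉ ∘ trans (cong mergedCol (col-cell r′ i′))

        i′≢ : i′ ≢ punchIn b c
        i′≢ i′≡ = i′∉ (trans (cong mergedCol i′≡) (merge-punchIn b≢i c))

        not-uv : ¬ (cell r′ i′ ≡ u × cell r′ (punchIn b c) ≡ v)
        not-uv (x≡u , y≡v) = i′∉ (begin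
          mergedCol i′             ≡⟨ cong mergedCol (proj₂ (combine-injective r′ i′ r i x≡u)) ⟩
          mergedCol i              ≡⟨ mergedCol-j≡i ⟨
          mergedCol j              ≡⟨ cong mergedCol (proj₂ (combine-injective r′ _ s j y≡v)) ⟨
          mergedCol (punchIn b c)  ≡⟨ merge-punchIn b≢i c ⟩
          c                        ∎)
          where open ≡-Reasoning

    twoCycle-notInDominating : ∀ {S w} → Decidable S → InDominating G S →
      (∀ z → z ∈ S → z ≡ v ⊎ z ≡ w) → arc G v w ≡ true → arc G w v ≡ true → ⊥
    twoCycle-notInDominating {S} {w} S? dom only v→w w→v with cellView w
    ... | cellAt s′ j′ with s ≟ s′
    ...   | yes refl = rowPair-notInDominating {G = G} {S} {s} {j} {j′} G⊆rook dom only
    ...   | no s≢s′ with arc-cases s j s′ j′ (G⊆rook v (cell s′ j′) v→w)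
    ...     | inj₁ (s≡s′ , _) = s≢s′ s≡s′
    ...     | inj₂ (_ , refl) with S? u
    ...       | yes uS = [ u≢v , (λ u≡w → ¬G-uv (subst (λ x → arc G x v ≡ true) (sym u≡w) w→v)) ]′
                           (only u uS)
    ...       | no u∉S with dom u u∉S
    ...         | z , zS , u→z with only z zS
    ...           | inj₁ refl = ¬G-uv u→z
    ...           | inj₂ refl = column-noCommonInNeighbour {u} s≢s′ u→v (G⊆rook u z u→z)

    -- With n classes on 2n vertices every class is a pair, and a strong pair is a 2-cycle.
    no-fullPartition : ¬ StrongInDomaticPartition G n
    no-fullPartition (c , onto , sid)
      with ClassPairs.classmate (classes-twoMembers {D = G} G-nonInNeighbours onto (proj₁ ∘ sid))
                                ℕ.≤-refl v
    ... | w , cw , v≢w , only =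
      twoCycle-notInDominating (λ x → c x ≟ c v) dom only
        (walk⇒arc {D = G} {S = Class c (c v)} only v≢w (strong v w refl cw))
        (walk⇒arc {D = G} {S = Class c (c v)} (λ z → Sum.swap ∘ only z) (v≢w ∘ sym)
                  (strong w v cw refl))
      where
      dom = proj₁ (sid (c v))
      strong = proj₂ (sid (c v))

    G-number : StrongInDomaticNumber G (pred n)
    G-number = mergedPartition , λ _ p →
      ℕ.≤-pred (ℕ.≤∧≢⇒< (subdigraph-bound {G} G⊆rook p) λ { refl → no-fullPartition p })

  rook-critical : StrongInDomaticCritical rook n
  rook-critical = rook-number , deleted
    where
    deleted : ∀ u v → rookArc u v ≡ true →
              Strong (deleteArc rook u v) × StrongInDomaticNumber (deleteArc rook u v) (pred n)
    deleted u v u→v with cellView u | cellView v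
    ... | cellAt r i | cellAt s j =
      Deleted.G-strong {r} {s} {i} {j} u→v , Deleted.G-number {r} {s} {i} {j} u→v

corollary3 : (n : ℕ) → 3 ≤ n →
    Σ (Digraph (2 * n)) λ D → StrongInDomaticCritical D n
corollary3 (suc (suc (suc k))) (s≤s (s≤s (s≤s _))) = Rook.rook k , Rook.rook-critical k
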